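{- Each of the rules $\mathsf{w}\downarrow$ and $\mathsf{ai}\downarrow$ permutes over each of the rules $\mathsf{e}\uparrow$, $\mathsf{ai}\downarrow$, $\mathsf{ai}\uparrow$, $\mathsf{s}$, $\mathsf{q}\downarrow$, $\mathsf{q}\uparrow$, $\mathsf{p}\downarrow$, $\mathsf{p}\uparrow$, $\mathsf{w}\uparrow$, and $\mathsf{g}\downarrow$ by the system $\{\mathsf{s},\mathsf{q}\downarrow,\mathsf{q}\uparrow\}$.
   Context: Atoms: countably many atoms $a,b,\dots$, each atom $a$ having a dual atom $\bar a$ with $\bar{\bar a}=a$. Structures are generated by $S::= a\mid \circ \mid [S,\dots,S]\mid (S,\dots,S)\mid \langle S;\dots;S\rangle \mid ?S\mid !S\mid \bar S$ (par, tensor, seq with at least one argument; unit $\circ$ not an atom), identified modulo the least congruence $=$ making par, tensor, seq associative, par and tensor commutative, $\circ$ a unit for all three, $[R]=(R)=\langle R\rangle=R$, with $\bar\circ=\circ$, $\overline{[R_1,\dots,R_h]}=(\bar R_1,\dots,\bar R_h)$, $\overline{(R_1,\dots,R_h)}=[\bar R_1,\dots,\bar R_h]$, $\overline{\langle R_1;\dots;R_h\rangle}=\langle\bar R_1;\dots;\bar R_h\rangle$, $\overline{?R}=!\bar R$, $\overline{!R}=?\bar R$, $\bar{\bar R}=R$. A context $S\{\;\}$ is a structure with one hole not under negation; $S[R,T]$ abbreviates $S\{[R,T]\}$ etc. A derivation in a rule set is a finite vertical chain of rule instances (each conclusion equal modulo $=$ to the next premise), possibly a single structure; top = premise, bottom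 = conclusion. Rules (premise $\Rightarrow$ conclusion): $\mathsf{ai}\downarrow$: $S\{\circ\}\Rightarrow S[a,\bar a]$; $\mathsf{ai}\uparrow$: $S(a,\bar a)\Rightarrow S\{\circ\}$; $\mathsf{s}$: $S([R,U],T)\Rightarrow S[(R,T),U]$; $\mathsf{q}\downarrow$: $S\langle[R,U];[T,V]\rangle\Rightarrow S[\langle R;T\rangle,\langle U;V\rangle]$; $\mathsf{q}\uparrow$: $S(\langle R;U\rangle,\langle T;V\rangle)\Rightarrow S\langle(R,T);(U,V)\rangle$; $\mathsf{p}\downarrow$: $S\{![R,T]\}\Rightarrow S[!R,?T]$; $\mathsf{p}\uparrow$: $S(?R,!T)\Rightarrow S\{?(R,T)\}$; $\mathsf{e}\uparrow$: $S\{?\circ\}\Rightarrow S\{\circ\}$; $\mathsf{w}\downarrow$: $S\{\circ\}\Rightarrow S\{?R\}$; $\mathsf{w}\uparrow$: $S\{!R\}\Rightarrow S\{\circ\}$; $\mathsf{g}\downarrow$: $S\{??R\}\Rightarrow S\{?R\}$. A rule $\pi$ permutes over a rule $\rho$ by a system $\mathcal X$ if for every derivation consisting of an instance of $\rho$ with premise $Q$ and conclusion $U$ followed (below) by an instance of $\pi$ with premise $U$ and conclusion $P$, there are structures $V,W$ and a derivation consisting of an instance of $\pi$ from $Q$ to $V$, followed by an instance of $\rho$ from $V$ to $W$, followed by a derivation in $\mathcal X$ from $W$ to $P$. -}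

module Defs where

open import Data.Nat using (ℕ)
open import Data.Bool using (Bool; not)
open import Data.Product using (_×_; _,_; Σ; ∃; ∃-syntax)

Atom : Set
Atom = ℕ × Bool

dual : Atom → Atom
dual (n , b) = (n , not b)

-- The n-ary par/tensor/seq (n ≥ 1) are
-- represented by binary constructors; modulo associativity (and
-- [R] = (R) = <R> = R) this is the same set of structures.
-- Negation is defined as a function pushing the bar to the atoms,
-- exactly by the defining equations of the paper.

infixr 20 _⅋_ _⊗_ _◁_

data Str : Set where
  atom  : Atom → Str
  ∘     : Str
  _⅋_   : Str → Str → Str
  _⊗_   : Str → Str → Str
  _◁_   : Str → Str → Str
  `?    : Str → Str
  `!    : Str → Str

neg : Str → Str
neg (atom a) = atom (dual a)
neg ∘        = ∘
neg (R ⅋ T)  = neg R ⊗ neg T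
neg (R ⊗ T)  = neg R ⅋ neg T
neg (R ◁ T)  = neg R ◁ neg T
neg (`? R)   = `! (neg R)
neg (`! R)   = `? (neg R)

infix 4 _≈_

data _≈_ : Str → Str → Set where
  ≈-refl  : ∀ {R} → R ≈ R
  ≈-sym   : ∀ {R T} → R ≈ T → T ≈ R
  ≈-trans : ∀ {R T U} → R ≈ T → T ≈ U → R ≈ U
  ⅋-cong  : ∀ {R R' T T'} → R ≈ R' → T ≈ T' → (R ⅋ T) ≈ (R' ⅋ T')
  ⊗-cong  : ∀ {R R' T T'} → R ≈ R' → T ≈ T' → (R ⊗ T) ≈ (R' ⊗ T')
  ◁-cong  : ∀ {R R' T T'} → R ≈ R' → T ≈ T' → (R ◁ T) ≈ (R' ◁ T')
  ?-cong  : ∀ {R R'} → R ≈ R' → `? R ≈ `? R'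
  !-cong  : ∀ {R R'} → R ≈ R' → `! R ≈ `! R'
  ⅋-assoc : ∀ R T U → ((R ⅋ T) ⅋ U) ≈ (R ⅋ (T ⅋ U))
  ⊗-assoc : ∀ R T U → ((R ⊗ T) ⊗ U) ≈ (R ⊗ (T ⊗ U))
  ◁-assoc : ∀ R T U → ((R ◁ T) ◁ U) ≈ (R ◁ (T ◁ U))
  ⅋-comm  : ∀ R T → (R ⅋ T) ≈ (T ⅋ R)
  ⊗-comm  : ∀ R T → (R ⊗ T) ≈ (T ⊗ R)
  ⅋-unitˡ : ∀ R → (∘ ⅋ R) ≈ R
  ⅋-unitʳ : ∀ R → (R ⅋ ∘) ≈ R
  ⊗-unitˡ : ∀ R → (∘ ⊗ R) ≈ R
  ⊗-unitʳ : ∀ R → (R ⊗ ∘) ≈ R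
  ◁-unitˡ : ∀ R → (∘ ◁ R) ≈ R
  ◁-unitʳ : ∀ R → (R ◁ ∘) ≈ R

data Ctx : Set where
  □    : Ctx
  _⅋ₗ_ : Ctx → Str → Ctx
  _⅋ᵣ_ : Str → Ctx → Ctx
  _⊗ₗ_ : Ctx → Str → Ctx
  _⊗ᵣ_ : Str → Ctx → Ctx
  _◁ₗ_ : Ctx → Str → Ctx
  _◁ᵣ_ : Str → Ctx → Ctx
  ?C   : Ctx → Ctx
  !C   : Ctx → Ctx

_⟦_⟧ : Ctx → Str → Str
□ ⟦ R ⟧        = R
(C ⅋ₗ T) ⟦ R ⟧ = (C ⟦ R ⟧) ⅋ T
(T ⅋ᵣ C) ⟦ R ⟧ = T ⅋ (C ⟦ R ⟧)
(C ⊗ₗ T) ⟦ R ⟧ = (C ⟦ R ⟧) ⊗ T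
(T ⊗ᵣ C) ⟦ R ⟧ = T ⊗ (C ⟦ R ⟧)
(C ◁ₗ T) ⟦ R ⟧ = (C ⟦ R ⟧) ◁ T
(T ◁ᵣ C) ⟦ R ⟧ = T ◁ (C ⟦ R ⟧)
?C C ⟦ R ⟧     = `? (C ⟦ R ⟧)
!C C ⟦ R ⟧     = `! (C ⟦ R ⟧)

data Rule : Set where
  ai↓ ai↑ s q↓ q↑ p↓ p↑ e↑ w↓ w↑ g↓ : Rule

-- Redexes: Ax ρ L R means ρ rewrites L (in the premise) into R (in the
-- conclusion) inside the hole of a context.
data Ax : Rule → Str → Str → Set where
  ai↓ : ∀ a → Ax ai↓ ∘ (atom a ⅋ atom (dual a))
  ai↑ : ∀ a → Ax ai↑ (atom a ⊗ atom (dual a)) ∘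
  s   : ∀ R U T → Ax s ((R ⅋ U) ⊗ T) ((R ⊗ T) ⅋ U)
  q↓  : ∀ R T U V → Ax q↓ ((R ⅋ U) ◁ (T ⅋ V)) ((R ◁ T) ⅋ (U ◁ V))
  q↑  : ∀ R T U V → Ax q↑ ((R ◁ U) ⊗ (T ◁ V)) ((R ⊗ T) ◁ (U ⊗ V))
  p↓  : ∀ R T → Ax p↓ (`! (R ⅋ T)) (`! R ⅋ `? T)
  p↑  : ∀ R T → Ax p↑ (`? R ⊗ `! T) (`? (R ⊗ T))
  e↑  : Ax e↑ (`? ∘) ∘
  w↓  : ∀ R → Ax w↓ ∘ (`? R)
  w↑  : ∀ R → Ax w↑ (`! R) ∘
  g↓  : ∀ R → Ax g↓ (`? (`? R)) (`? R)

-- An instance of ρ with premise Q and conclusion U (structures are taken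
-- modulo ≈, so premise/conclusion are only required to be ≈ to S{L}, S{R}).
record Inst (ρ : Rule) (Q U : Str) : Set where
  constructor inst
  field
    ctx     : Ctx
    lhs rhs : Str
    redex   : Ax ρ lhs rhs
    premise≈    : Q ≈ ctx ⟦ lhs ⟧
    conclusion≈ : U ≈ ctx ⟦ rhs ⟧

-- Derivations in a system 𝒳 (a predicate on rules), top W to bottom P;
-- possibly just a single structure (then W = P modulo ≈).
data Deriv (𝒳 : Rule → Set) : Str → Str → Set where
  single : ∀ {W P} → W ≈ P → Deriv 𝒳 W P
  step   : ∀ {W W' P} (ρ : Rule) → 𝒳 ρ → Inst ρ W W' → Deriv 𝒳 W' P → Deriv 𝒳 W P

PermutesOver : Rule → Rule → (Rule → Set) → Set
PermutesOver π ρ 𝒳 =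
  ∀ {Q U P} → Inst ρ Q U → Inst π U P →
  Σ Str λ V → Σ Str λ W → Inst π Q V × Inst ρ V W × Deriv 𝒳 W P

data SQ : Rule → Set where
  s  : SQ s
  q↓ : SQ q↓
  q↑ : SQ q↑

data Lower : Rule → Set where
  w↓  : Lower w↓
  ai↓ : Lower ai↓

data Upper : Rule → Set where
  e↑  : Upper e↑
  ai↓ : Upper ai↓
  ai↑ : Upper ai↑
  s   : Upper s
  q↓  : Upper q↓
  q↑  : Upper q↑
  p↓  : Upper p↓
  p↑  : Upper p↑
  w↑  : Upper w↑
  g↓  : Upper g↓

-- The lower rule inserts a structure X at an occurrence of the unit. Modulo the
-- equations that occurrence is only determined up to its site: the body of the
-- innermost exponential above it, or the root, since X tensored at that site
-- is pushed down through pars, tensors and seqs to the unit by switch and q↑.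
-- Sites are preserved by the congruence, so the site is found in the
-- conclusion of the upper rule as written. There it lies above the redex,
-- beside it, inside a metavariable of it, or is an exponential node that the
-- upper rule carries over from its premise (this is what fails for w↓). In
-- each case X can be tensored at the corresponding site of the premise first
-- and the upper rule applied afterwards.
module Submission where

open import Data.Product using (Σ-syntax; _×_; _,_; map)
open import Relation.Binary.PropositionalEquality using (_≡_; refl)

open import Defs

private
  variable
    π ρ : Rule
    A B L R : Str

⊗-exchange : ∀ A B C → (A ⊗ B) ⊗ C ≈ (A ⊗ C) ⊗ B
⊗-exchange A B C =
  ≈-trans (⊗-assoc A B C) (≈-trans (⊗-cong ≈-refl (⊗-comm B C)) (≈-sym (⊗-assoc A C B)))

_⊙_ : Ctx → Ctx → Ctx
□ ⊙ G        = G
(F ⅋ₗ T) ⊙ G = (F ⊙ G) ⅋ₗ T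
(T ⅋ᵣ F) ⊙ G = T ⅋ᵣ (F ⊙ G)
(F ⊗ₗ T) ⊙ G = (F ⊙ G) ⊗ₗ T
(T ⊗ᵣ F) ⊙ G = T ⊗ᵣ (F ⊙ G)
(F ◁ₗ T) ⊙ G = (F ⊙ G) ◁ₗ T
(T ◁ᵣ F) ⊙ G = T ◁ᵣ (F ⊙ G)
?C F ⊙ G     = ?C (F ⊙ G)
!C F ⊙ G     = !C (F ⊙ G)

plug-cong : ∀ F → A ≈ B → F ⟦ A ⟧ ≈ F ⟦ B ⟧
plug-cong □ p        = p
plug-cong (F ⅋ₗ T) p = ⅋-cong (plug-cong F p) ≈-refl
plug-cong (T ⅋ᵣ F) p = ⅋-cong ≈-refl (plug-cong F p)
plug-cong (F ⊗ₗ T) p = ⊗-cong (plug-cong F p) ≈-refl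
plug-cong (T ⊗ᵣ F) p = ⊗-cong ≈-refl (plug-cong F p)
plug-cong (F ◁ₗ T) p = ◁-cong (plug-cong F p) ≈-refl
plug-cong (T ◁ᵣ F) p = ◁-cong ≈-refl (plug-cong F p)
plug-cong (?C F) p   = ?-cong (plug-cong F p)
plug-cong (!C F) p   = !-cong (plug-cong F p)

plug-⊙ : ∀ F G A → F ⟦ G ⟦ A ⟧ ⟧ ≈ (F ⊙ G) ⟦ A ⟧
plug-⊙ □ G A        = ≈-refl
plug-⊙ (F ⅋ₗ T) G A = ⅋-cong (plug-⊙ F G A) ≈-refl
plug-⊙ (T ⅋ᵣ F) G A = ⅋-cong ≈-refl (plug-⊙ F G A)
plug-⊙ (F ⊗ₗ T) G A = ⊗-cong (plug-⊙ F G A) ≈-refl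
plug-⊙ (T ⊗ᵣ F) G A = ⊗-cong ≈-refl (plug-⊙ F G A)
plug-⊙ (F ◁ₗ T) G A = ◁-cong (plug-⊙ F G A) ≈-refl
plug-⊙ (T ◁ᵣ F) G A = ◁-cong ≈-refl (plug-⊙ F G A)
plug-⊙ (?C F) G A   = ?-cong (plug-⊙ F G A)
plug-⊙ (!C F) G A   = !-cong (plug-⊙ F G A)

axiom : Ax ρ L R → Inst ρ L R
axiom {L = L} {R} ax = inst □ L R ax ≈-refl ≈-refl

Inst-respˡ-≈ : B ≈ A → Inst ρ A R → Inst ρ B R
Inst-respˡ-≈ p (inst C L R ax q u) = inst C L R ax (≈-trans p q) u

Inst-respʳ-≈ : A ≈ B → Inst ρ L A → Inst ρ L B
Inst-respʳ-≈ p (inst C L R ax q u) = inst C L R ax q (≈-trans (≈-sym p) u)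

Inst-cong : ∀ F → Inst ρ A B → Inst ρ (F ⟦ A ⟧) (F ⟦ B ⟧)
Inst-cong F (inst C L R ax q u) =
  inst (F ⊙ C) L R ax (≈-trans (plug-cong F q) (plug-⊙ F C L))
                      (≈-trans (plug-cong F u) (plug-⊙ F C R))

module _ {𝒳 : Rule → Set} where

  Deriv-respˡ-≈ : B ≈ A → Deriv 𝒳 A R → Deriv 𝒳 B R
  Deriv-respˡ-≈ p (single q)     = single (≈-trans p q)
  Deriv-respˡ-≈ p (step ρ x i d) = step ρ x (Inst-respˡ-≈ p i) d

  Deriv-respʳ-≈ : A ≈ B → Deriv 𝒳 L A → Deriv 𝒳 L B
  Deriv-respʳ-≈ p (single q)     = single (≈-trans q p)
  Deriv-respʳ-≈ p (step ρ x i d) = step ρ x i (Deriv-respʳ-≈ p d)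

  Deriv-cong : ∀ F → Deriv 𝒳 A B → Deriv 𝒳 (F ⟦ A ⟧) (F ⟦ B ⟧)
  Deriv-cong F (single p)     = single (plug-cong F p)
  Deriv-cong F (step ρ x i d) = step ρ x (Inst-cong F i) (Deriv-cong F d)

-- A site of a structure is its root or the body of one of its ? or ! nodes,
-- and a structure Y is grafted there by tensoring it with the body. Unlike
-- arbitrary positions, sites survive associativity, commutativity and units.

data Site : Str → Set
data Node : Str → Set

data Site where
  root : Site A
  node : Node A → Site A

data Node where
  ?ⁿ : Site A → Node (`? A)
  !ⁿ : Site A → Node (`! A)
  ⅋ˡ : Node A → Node (A ⅋ B)
  ⅋ʳ : Node B → Node (A ⅋ B)
  ⊗ˡ : Node A → Node (A ⊗ B)
  ⊗ʳ : Node B → Node (A ⊗ B)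
  ◁ˡ : Node A → Node (A ◁ B)
  ◁ʳ : Node B → Node (A ◁ B)

graft  : Site A → Ctx
graftⁿ : Node A → Ctx

graft {A} root = A ⊗ᵣ □
graft (node n) = graftⁿ n

graftⁿ (?ⁿ σ) = ?C (graft σ)
graftⁿ (!ⁿ σ) = !C (graft σ)
graftⁿ (⅋ˡ {B = B} n) = graftⁿ n ⅋ₗ B
graftⁿ (⅋ʳ {A = A} n) = A ⅋ᵣ graftⁿ n
graftⁿ (⊗ˡ {B = B} n) = graftⁿ n ⊗ₗ B
graftⁿ (⊗ʳ {A = A} n) = A ⊗ᵣ graftⁿ n
graftⁿ (◁ˡ {B = B} n) = graftⁿ n ◁ₗ B
graftⁿ (◁ʳ {A = A} n) = A ◁ᵣ graftⁿ n

graft-unit  : (σ : Site A) → A ≈ graft σ ⟦ ∘ ⟧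
graftⁿ-unit : (n : Node A) → A ≈ graftⁿ n ⟦ ∘ ⟧

graft-unit {A} root = ≈-sym (⊗-unitʳ A)
graft-unit (node n) = graftⁿ-unit n

graftⁿ-unit (?ⁿ σ) = ?-cong (graft-unit σ)
graftⁿ-unit (!ⁿ σ) = !-cong (graft-unit σ)
graftⁿ-unit (⅋ˡ n) = ⅋-cong (graftⁿ-unit n) ≈-refl
graftⁿ-unit (⅋ʳ n) = ⅋-cong ≈-refl (graftⁿ-unit n)
graftⁿ-unit (⊗ˡ n) = ⊗-cong (graftⁿ-unit n) ≈-refl
graftⁿ-unit (⊗ʳ n) = ⊗-cong ≈-refl (graftⁿ-unit n)
graftⁿ-unit (◁ˡ n) = ◁-cong (graftⁿ-unit n) ≈-refl
graftⁿ-unit (◁ʳ n) = ◁-cong ≈-refl (graftⁿ-unit n)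

_≈ˢ_ : Site A → Site B → Set
σ ≈ˢ τ = ∀ Y → graft σ ⟦ Y ⟧ ≈ graft τ ⟦ Y ⟧

_≈ⁿ_ : Node A → Node B → Set
n ≈ⁿ m = ∀ Y → graftⁿ n ⟦ Y ⟧ ≈ graftⁿ m ⟦ Y ⟧

NodeTransport : Str → Str → Set
NodeTransport A B = (n : Node A) → Σ[ m ∈ Node B ] n ≈ⁿ m

_⨾_ : ∀ {A B D} → NodeTransport A B → NodeTransport B D → NodeTransport A D
(t ⨾ u) n with t n
... | m , n≈m with u m
...   | k , m≈k = k , λ Y → ≈-trans (n≈m Y) (m≈k Y)

site-transport : A ≈ B → NodeTransport A B → (σ : Site A) → Σ[ τ ∈ Site B ] σ ≈ˢ τ
site-transport p t root     = root , λ Y → ⊗-cong p ≈-refl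
site-transport p t (node n) = map node (λ n≈m → n≈m) (t n)

⅋-commⁿ : NodeTransport (A ⅋ B) (B ⅋ A)
⅋-commⁿ (⅋ˡ n) = ⅋ʳ n , λ Y → ⅋-comm _ _
⅋-commⁿ (⅋ʳ n) = ⅋ˡ n , λ Y → ⅋-comm _ _

⊗-commⁿ : NodeTransport (A ⊗ B) (B ⊗ A)
⊗-commⁿ (⊗ˡ n) = ⊗ʳ n , λ Y → ⊗-comm _ _
⊗-commⁿ (⊗ʳ n) = ⊗ˡ n , λ Y → ⊗-comm _ _

transportⁿ  : A ≈ B → NodeTransport A B
transportⁿ⁻ : A ≈ B → NodeTransport B A

transportⁿ ≈-refl n        = n , λ Y → ≈-refl
transportⁿ (≈-sym p)       = transportⁿ⁻ p
transportⁿ (≈-trans p q)   = transportⁿ p ⨾ transportⁿ q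
transportⁿ (⅋-cong p q) (⅋ˡ n) = map ⅋ˡ (λ h Y → ⅋-cong (h Y) q) (transportⁿ p n)
transportⁿ (⅋-cong p q) (⅋ʳ n) = map ⅋ʳ (λ h Y → ⅋-cong p (h Y)) (transportⁿ q n)
transportⁿ (⊗-cong p q) (⊗ˡ n) = map ⊗ˡ (λ h Y → ⊗-cong (h Y) q) (transportⁿ p n)
transportⁿ (⊗-cong p q) (⊗ʳ n) = map ⊗ʳ (λ h Y → ⊗-cong p (h Y)) (transportⁿ q n)
transportⁿ (◁-cong p q) (◁ˡ n) = map ◁ˡ (λ h Y → ◁-cong (h Y) q) (transportⁿ p n)
transportⁿ (◁-cong p q) (◁ʳ n) = map ◁ʳ (λ h Y → ◁-cong p (h Y)) (transportⁿ q n)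
transportⁿ (?-cong p) (?ⁿ σ) = map ?ⁿ (λ h Y → ?-cong (h Y)) (site-transport p (transportⁿ p) σ)
transportⁿ (!-cong p) (!ⁿ σ) = map !ⁿ (λ h Y → !-cong (h Y)) (site-transport p (transportⁿ p) σ)
transportⁿ (⅋-assoc _ _ _) (⅋ˡ (⅋ˡ n)) = ⅋ˡ n , λ Y → ⅋-assoc _ _ _
transportⁿ (⅋-assoc _ _ _) (⅋ˡ (⅋ʳ n)) = ⅋ʳ (⅋ˡ n) , λ Y → ⅋-assoc _ _ _
transportⁿ (⅋-assoc _ _ _) (⅋ʳ n)      = ⅋ʳ (⅋ʳ n) , λ Y → ⅋-assoc _ _ _
transportⁿ (⊗-assoc _ _ _) (⊗ˡ (⊗ˡ n)) = ⊗ˡ n , λ Y → ⊗-assoc _ _ _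
transportⁿ (⊗-assoc _ _ _) (⊗ˡ (⊗ʳ n)) = ⊗ʳ (⊗ˡ n) , λ Y → ⊗-assoc _ _ _
transportⁿ (⊗-assoc _ _ _) (⊗ʳ n)      = ⊗ʳ (⊗ʳ n) , λ Y → ⊗-assoc _ _ _
transportⁿ (◁-assoc _ _ _) (◁ˡ (◁ˡ n)) = ◁ˡ n , λ Y → ◁-assoc _ _ _
transportⁿ (◁-assoc _ _ _) (◁ˡ (◁ʳ n)) = ◁ʳ (◁ˡ n) , λ Y → ◁-assoc _ _ _
transportⁿ (◁-assoc _ _ _) (◁ʳ n)      = ◁ʳ (◁ʳ n) , λ Y → ◁-assoc _ _ _
transportⁿ (⅋-comm _ _) = ⅋-commⁿ
transportⁿ (⊗-comm _ _) = ⊗-commⁿ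
transportⁿ (⅋-unitˡ _) (⅋ʳ n) = n , λ Y → ⅋-unitˡ _
transportⁿ (⅋-unitʳ _) (⅋ˡ n) = n , λ Y → ⅋-unitʳ _
transportⁿ (⊗-unitˡ _) (⊗ʳ n) = n , λ Y → ⊗-unitˡ _
transportⁿ (⊗-unitʳ _) (⊗ˡ n) = n , λ Y → ⊗-unitʳ _
transportⁿ (◁-unitˡ _) (◁ʳ n) = n , λ Y → ◁-unitˡ _
transportⁿ (◁-unitʳ _) (◁ˡ n) = n , λ Y → ◁-unitʳ _

transportⁿ⁻ ≈-refl n        = n , λ Y → ≈-refl
transportⁿ⁻ (≈-sym p)       = transportⁿ p
transportⁿ⁻ (≈-trans p q)   = transportⁿ⁻ q ⨾ transportⁿ⁻ p
transportⁿ⁻ (⅋-cong p q) (⅋ˡ n) = map ⅋ˡ (λ h Y → ⅋-cong (h Y) (≈-sym q)) (transportⁿ⁻ p n)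
transportⁿ⁻ (⅋-cong p q) (⅋ʳ n) = map ⅋ʳ (λ h Y → ⅋-cong (≈-sym p) (h Y)) (transportⁿ⁻ q n)
transportⁿ⁻ (⊗-cong p q) (⊗ˡ n) = map ⊗ˡ (λ h Y → ⊗-cong (h Y) (≈-sym q)) (transportⁿ⁻ p n)
transportⁿ⁻ (⊗-cong p q) (⊗ʳ n) = map ⊗ʳ (λ h Y → ⊗-cong (≈-sym p) (h Y)) (transportⁿ⁻ q n)
transportⁿ⁻ (◁-cong p q) (◁ˡ n) = map ◁ˡ (λ h Y → ◁-cong (h Y) (≈-sym q)) (transportⁿ⁻ p n)
transportⁿ⁻ (◁-cong p q) (◁ʳ n) = map ◁ʳ (λ h Y → ◁-cong (≈-sym p) (h Y)) (transportⁿ⁻ q n)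
transportⁿ⁻ (?-cong p) (?ⁿ σ) = map ?ⁿ (λ h Y → ?-cong (h Y)) (site-transport (≈-sym p) (transportⁿ⁻ p) σ)
transportⁿ⁻ (!-cong p) (!ⁿ σ) = map !ⁿ (λ h Y → !-cong (h Y)) (site-transport (≈-sym p) (transportⁿ⁻ p) σ)
transportⁿ⁻ (⅋-assoc _ _ _) (⅋ˡ n)      = ⅋ˡ (⅋ˡ n) , λ Y → ≈-sym (⅋-assoc _ _ _)
transportⁿ⁻ (⅋-assoc _ _ _) (⅋ʳ (⅋ˡ n)) = ⅋ˡ (⅋ʳ n) , λ Y → ≈-sym (⅋-assoc _ _ _)
transportⁿ⁻ (⅋-assoc _ _ _) (⅋ʳ (⅋ʳ n)) = ⅋ʳ n , λ Y → ≈-sym (⅋-assoc _ _ _)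
transportⁿ⁻ (⊗-assoc _ _ _) (⊗ˡ n)      = ⊗ˡ (⊗ˡ n) , λ Y → ≈-sym (⊗-assoc _ _ _)
transportⁿ⁻ (⊗-assoc _ _ _) (⊗ʳ (⊗ˡ n)) = ⊗ˡ (⊗ʳ n) , λ Y → ≈-sym (⊗-assoc _ _ _)
transportⁿ⁻ (⊗-assoc _ _ _) (⊗ʳ (⊗ʳ n)) = ⊗ʳ n , λ Y → ≈-sym (⊗-assoc _ _ _)
transportⁿ⁻ (◁-assoc _ _ _) (◁ˡ n)      = ◁ˡ (◁ˡ n) , λ Y → ≈-sym (◁-assoc _ _ _)
transportⁿ⁻ (◁-assoc _ _ _) (◁ʳ (◁ˡ n)) = ◁ˡ (◁ʳ n) , λ Y → ≈-sym (◁-assoc _ _ _)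
transportⁿ⁻ (◁-assoc _ _ _) (◁ʳ (◁ʳ n)) = ◁ʳ n , λ Y → ≈-sym (◁-assoc _ _ _)
transportⁿ⁻ (⅋-comm _ _) = ⅋-commⁿ
transportⁿ⁻ (⊗-comm _ _) = ⊗-commⁿ
transportⁿ⁻ (⅋-unitˡ _) n = ⅋ʳ n , λ Y → ≈-sym (⅋-unitˡ _)
transportⁿ⁻ (⅋-unitʳ _) n = ⅋ˡ n , λ Y → ≈-sym (⅋-unitʳ _)
transportⁿ⁻ (⊗-unitˡ _) n = ⊗ʳ n , λ Y → ≈-sym (⊗-unitˡ _)
transportⁿ⁻ (⊗-unitʳ _) n = ⊗ˡ n , λ Y → ≈-sym (⊗-unitʳ _)
transportⁿ⁻ (◁-unitˡ _) n = ◁ʳ n , λ Y → ≈-sym (◁-unitˡ _)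
transportⁿ⁻ (◁-unitʳ _) n = ◁ˡ n , λ Y → ≈-sym (◁-unitʳ _)

transport : A ≈ B → (σ : Site A) → Σ[ τ ∈ Site B ] σ ≈ˢ τ
transport p = site-transport p (transportⁿ p)

switchʳ : ∀ T A Y → Inst s ((T ⅋ A) ⊗ Y) (T ⅋ (A ⊗ Y))
switchʳ T A Y = inst □ _ _ (s A T Y) (⊗-cong (⅋-comm T A) ≈-refl) (⅋-comm T (A ⊗ Y))

seqˡ : ∀ A T Y → Inst q↑ ((A ◁ T) ⊗ Y) ((A ⊗ Y) ◁ T)
seqˡ A T Y = inst □ _ _ (q↑ A Y T ∘) (⊗-cong ≈-refl (≈-sym (◁-unitʳ Y)))
                                     (◁-cong ≈-refl (≈-sym (⊗-unitʳ T)))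

seqʳ : ∀ T A Y → Inst q↑ ((T ◁ A) ⊗ Y) (T ◁ (A ⊗ Y))
seqʳ T A Y = inst □ _ _ (q↑ T ∘ A Y) (⊗-cong ≈-refl (≈-sym (◁-unitˡ Y)))
                                     (◁-cong (≈-sym (⊗-unitʳ T)) ≈-refl)

SinksInto : Site A → Ctx → Str → Set
SinksInto σ C Z = ∀ Y → Deriv SQ (graft σ ⟦ Y ⟧) (C ⟦ Z ⊗ Y ⟧)

hole-site : ∀ C Z → Σ[ σ ∈ Site (C ⟦ Z ⟧) ] SinksInto σ C Z
hole-site □ Z = root , λ Y → single ≈-refl
hole-site (C ⅋ₗ T) Z with hole-site C Z
... | root , d   = root , λ Y → step s s (axiom (s _ T Y)) (Deriv-cong (□ ⅋ₗ T) (d Y))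
... | node n , d = node (⅋ˡ n) , λ Y → Deriv-cong (□ ⅋ₗ T) (d Y)
hole-site (T ⅋ᵣ C) Z with hole-site C Z
... | root , d   = root , λ Y → step s s (switchʳ T _ Y) (Deriv-cong (T ⅋ᵣ □) (d Y))
... | node n , d = node (⅋ʳ n) , λ Y → Deriv-cong (T ⅋ᵣ □) (d Y)
hole-site (C ⊗ₗ T) Z with hole-site C Z
... | root , d   = root , λ Y → Deriv-respˡ-≈ (⊗-exchange _ T Y) (Deriv-cong (□ ⊗ₗ T) (d Y))
... | node n , d = node (⊗ˡ n) , λ Y → Deriv-cong (□ ⊗ₗ T) (d Y)
hole-site (T ⊗ᵣ C) Z with hole-site C Z
... | root , d   = root , λ Y → Deriv-respˡ-≈ (⊗-assoc T _ Y) (Deriv-cong (T ⊗ᵣ □) (d Y))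
... | node n , d = node (⊗ʳ n) , λ Y → Deriv-cong (T ⊗ᵣ □) (d Y)
hole-site (C ◁ₗ T) Z with hole-site C Z
... | root , d   = root , λ Y → step q↑ q↑ (seqˡ _ T Y) (Deriv-cong (□ ◁ₗ T) (d Y))
... | node n , d = node (◁ˡ n) , λ Y → Deriv-cong (□ ◁ₗ T) (d Y)
hole-site (T ◁ᵣ C) Z with hole-site C Z
... | root , d   = root , λ Y → step q↑ q↑ (seqʳ T _ Y) (Deriv-cong (T ◁ᵣ □) (d Y))
... | node n , d = node (◁ʳ n) , λ Y → Deriv-cong (T ◁ᵣ □) (d Y)
hole-site (?C C) Z = map (λ σ → node (?ⁿ σ)) (λ d Y → Deriv-cong (?C □) (d Y)) (hole-site C Z)
hole-site (!C C) Z = map (λ σ → node (!ⁿ σ)) (λ d Y → Deriv-cong (!C □) (d Y)) (hole-site C Z)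

Permuted : Rule → Rule → Str → Str → Set
Permuted π ρ Q W = Σ[ V ∈ Str ] Inst π Q V × Inst ρ V W

Permuted-cong : ∀ F → Permuted π ρ A B → Permuted π ρ (F ⟦ A ⟧) (F ⟦ B ⟧)
Permuted-cong F (V , i , j) = F ⟦ V ⟧ , Inst-cong F i , Inst-cong F j

module _ {π X} (insertion : Ax π ∘ X) where

  insert : (σ : Site A) → Inst π A (graft σ ⟦ X ⟧)
  insert σ = inst (graft σ) ∘ X insertion (graft-unit σ) ≈-refl

  redex-permutes : Upper ρ → Ax ρ L R → (n : Node R) → Permuted π ρ L (graftⁿ n ⟦ X ⟧)
  redex-permutes e↑ e↑ ()
  redex-permutes ai↓ (ai↓ a) (⅋ˡ ())
  redex-permutes ai↓ (ai↓ a) (⅋ʳ ())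
  redex-permutes ai↑ (ai↑ a) ()
  redex-permutes w↑ (w↑ R) ()
  redex-permutes s (s R U T) (⅋ˡ (⊗ˡ n)) =
    _ , Inst-cong ((□ ⅋ₗ U) ⊗ₗ T) (insert (node n)) , axiom (s _ U T)
  redex-permutes s (s R U T) (⅋ˡ (⊗ʳ n)) =
    _ , Inst-cong ((R ⅋ U) ⊗ᵣ □) (insert (node n)) , axiom (s R U _)
  redex-permutes s (s R U T) (⅋ʳ n) =
    _ , Inst-cong ((R ⅋ᵣ □) ⊗ₗ T) (insert (node n)) , axiom (s R _ T)
  redex-permutes q↓ (q↓ R T U V) (⅋ˡ (◁ˡ n)) =
    _ , Inst-cong ((□ ⅋ₗ U) ◁ₗ (T ⅋ V)) (insert (node n)) , axiom (q↓ _ T U V)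
  redex-permutes q↓ (q↓ R T U V) (⅋ˡ (◁ʳ n)) =
    _ , Inst-cong ((R ⅋ U) ◁ᵣ (□ ⅋ₗ V)) (insert (node n)) , axiom (q↓ R _ U V)
  redex-permutes q↓ (q↓ R T U V) (⅋ʳ (◁ˡ n)) =
    _ , Inst-cong ((R ⅋ᵣ □) ◁ₗ (T ⅋ V)) (insert (node n)) , axiom (q↓ R T _ V)
  redex-permutes q↓ (q↓ R T U V) (⅋ʳ (◁ʳ n)) =
    _ , Inst-cong ((R ⅋ U) ◁ᵣ (T ⅋ᵣ □)) (insert (node n)) , axiom (q↓ R T U _)
  redex-permutes q↑ (q↑ R T U V) (◁ˡ (⊗ˡ n)) =
    _ , Inst-cong ((□ ◁ₗ U) ⊗ₗ (T ◁ V)) (insert (node n)) , axiom (q↑ _ T U V)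
  redex-permutes q↑ (q↑ R T U V) (◁ˡ (⊗ʳ n)) =
    _ , Inst-cong ((R ◁ U) ⊗ᵣ (□ ◁ₗ V)) (insert (node n)) , axiom (q↑ R _ U V)
  redex-permutes q↑ (q↑ R T U V) (◁ʳ (⊗ˡ n)) =
    _ , Inst-cong ((R ◁ᵣ □) ⊗ₗ (T ◁ V)) (insert (node n)) , axiom (q↑ R T _ V)
  redex-permutes q↑ (q↑ R T U V) (◁ʳ (⊗ʳ n)) =
    _ , Inst-cong ((R ◁ U) ⊗ᵣ (T ◁ᵣ □)) (insert (node n)) , axiom (q↑ R T U _)
  redex-permutes p↓ (p↓ R T) (⅋ˡ (!ⁿ σ)) =
    _ , Inst-cong (!C (□ ⅋ₗ T)) (insert σ) , axiom (p↓ _ T)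
  redex-permutes p↓ (p↓ R T) (⅋ʳ (?ⁿ σ)) =
    _ , Inst-cong (!C (R ⅋ᵣ □)) (insert σ) , axiom (p↓ R _)
  redex-permutes p↑ (p↑ R T) (?ⁿ root) =
    _ , Inst-cong (?C □ ⊗ₗ `! T) (insert root) ,
    Inst-respʳ-≈ (?-cong (⊗-exchange R X T)) (axiom (p↑ (R ⊗ X) T))
  redex-permutes p↑ (p↑ R T) (?ⁿ (node (⊗ˡ n))) =
    _ , Inst-cong (?C □ ⊗ₗ `! T) (insert (node n)) , axiom (p↑ _ T)
  redex-permutes p↑ (p↑ R T) (?ⁿ (node (⊗ʳ n))) =
    _ , Inst-cong (`? R ⊗ᵣ !C □) (insert (node n)) , axiom (p↑ R _)
  redex-permutes g↓ (g↓ R) (?ⁿ σ) =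
    _ , Inst-cong (?C (?C □)) (insert σ) , axiom (g↓ _)

  permutes-in-context : Upper ρ → Ax ρ L R → ∀ E (σ : Site (E ⟦ R ⟧)) →
                        Permuted π ρ (E ⟦ L ⟧) (graft σ ⟦ X ⟧)
  permutes-in-context {L = L} up ax E root = (E ⟦ L ⟧) ⊗ X , insert root , Inst-cong (E ⊗ₗ X) (axiom ax)
  permutes-in-context up ax □ (node n) = redex-permutes up ax n
  permutes-in-context up ax (E ⅋ₗ T) (node (⅋ˡ n)) =
    Permuted-cong (□ ⅋ₗ T) (permutes-in-context up ax E (node n))
  permutes-in-context up ax (T ⅋ᵣ E) (node (⅋ʳ n)) =
    Permuted-cong (T ⅋ᵣ □) (permutes-in-context up ax E (node n))
  permutes-in-context up ax (E ⊗ₗ T) (node (⊗ˡ n)) =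
    Permuted-cong (□ ⊗ₗ T) (permutes-in-context up ax E (node n))
  permutes-in-context up ax (T ⊗ᵣ E) (node (⊗ʳ n)) =
    Permuted-cong (T ⊗ᵣ □) (permutes-in-context up ax E (node n))
  permutes-in-context up ax (E ◁ₗ T) (node (◁ˡ n)) =
    Permuted-cong (□ ◁ₗ T) (permutes-in-context up ax E (node n))
  permutes-in-context up ax (T ◁ᵣ E) (node (◁ʳ n)) =
    Permuted-cong (T ◁ᵣ □) (permutes-in-context up ax E (node n))
  permutes-in-context up ax (?C E) (node (?ⁿ σ)) =
    Permuted-cong (?C □) (permutes-in-context up ax E σ)
  permutes-in-context up ax (!C E) (node (!ⁿ σ)) =
    Permuted-cong (!C □) (permutes-in-context up ax E σ)
  permutes-in-context {L = L} up ax (E ⅋ₗ T) (node (⅋ʳ n)) =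
    _ , Inst-cong ((E ⟦ L ⟧) ⅋ᵣ □) (insert (node n)) , Inst-cong (E ⅋ₗ _) (axiom ax)
  permutes-in-context {L = L} up ax (T ⅋ᵣ E) (node (⅋ˡ n)) =
    _ , Inst-cong (□ ⅋ₗ (E ⟦ L ⟧)) (insert (node n)) , Inst-cong (_ ⅋ᵣ E) (axiom ax)
  permutes-in-context {L = L} up ax (E ⊗ₗ T) (node (⊗ʳ n)) =
    _ , Inst-cong ((E ⟦ L ⟧) ⊗ᵣ □) (insert (node n)) , Inst-cong (E ⊗ₗ _) (axiom ax)
  permutes-in-context {L = L} up ax (T ⊗ᵣ E) (node (⊗ˡ n)) =
    _ , Inst-cong (□ ⊗ₗ (E ⟦ L ⟧)) (insert (node n)) , Inst-cong (_ ⊗ᵣ E) (axiom ax)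
  permutes-in-context {L = L} up ax (E ◁ₗ T) (node (◁ʳ n)) =
    _ , Inst-cong ((E ⟦ L ⟧) ◁ᵣ □) (insert (node n)) , Inst-cong (E ◁ₗ _) (axiom ax)
  permutes-in-context {L = L} up ax (T ◁ᵣ E) (node (◁ˡ n)) =
    _ , Inst-cong (□ ◁ₗ (E ⟦ L ⟧)) (insert (node n)) , Inst-cong (_ ◁ᵣ E) (axiom ax)

UnitPremise : Rule → Set
UnitPremise π = ∀ {L R} → Ax π L R → L ≡ ∘

unit-premise-permutes : UnitPremise π → Upper ρ → PermutesOver π ρ SQ
unit-premise-permutes unit up (inst E L R ax Q≈ U≈) (inst C _ X insertion U≈′ P≈)
  with unit insertion
... | refl with hole-site C ∘
... | σ , sinks with transport (≈-trans (≈-sym U≈′) U≈) σ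
... | τ , σ≈τ with permutes-in-context insertion up ax E τ
... | V , iπ , iρ =
  V , graft τ ⟦ X ⟧ , Inst-respˡ-≈ Q≈ iπ , iρ ,
  Deriv-respˡ-≈ (≈-sym (σ≈τ X))
    (Deriv-respʳ-≈ (≈-trans (plug-cong C (⊗-unitˡ X)) (≈-sym P≈)) (sinks X))

lower-unit-premise : Lower π → UnitPremise π
lower-unit-premise w↓ (w↓ R)   = refl
lower-unit-premise ai↓ (ai↓ a) = refl

lemma4p6 : (π ρ : Rule) → Lower π → Upper ρ → PermutesOver π ρ SQ
lemma4p6 π ρ lower upper = unit-premise-permutes (lower-unit-premise lower) upper
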